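{- For every finite set $X$, the external coproduct $\Delta:\mathbb T_X\to\bigoplus_{Y\subset X}\mathbb T_{X\setminus Y}\otimes\mathbb T_Y$, $\Delta(\mathcal T)=\sum_{Y\in\mathcal T}\mathcal T|_{X\setminus Y}\otimes\mathcal T|_Y$, is coassociative, i.e. $(\Delta\otimes I)\Delta=(I\otimes\Delta)\Delta$ as maps into $\bigoplus_{Z\subset Y\subset X}\mathbb T_{X\setminus Y}\otimes\mathbb T_{Y\setminus Z}\otimes\mathbb T_Z$, and multiplicative: for finite sets $X_1,X_2$ and topologies $\mathcal T_i$ on $X_i$, $\Delta(\mathcal T_1\mathcal T_2)=(m\otimes m)\circ\tau^{2,3}(\Delta(\mathcal T_1)\otimes\Delta(\mathcal T_2))$, where $\tau^{2,3}$ exchanges the second and third tensor factors.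
   Context: For a finite set $X$, $\mathbb T_X$ is the vector space freely generated by topologies on $X$. For $Y\subset X$, $\mathcal T|_Y=\{Z\cap Y:Z\in\mathcal T\}$ is the restricted topology; $Y\in\mathcal T$ means $Y$ is $\mathcal T$-open. The product $m:\mathbb T_{X_1}\otimes\mathbb T_{X_2}\to\mathbb T_{X_1\sqcup X_2}$ sends $\mathcal T_1\otimes\mathcal T_2$ to $\mathcal T_1\mathcal T_2$, where $Y\in\mathcal T_1\mathcal T_2$ iff $Y\cap X_1\in\mathcal T_1$ and $Y\cap X_2\in\mathcal T_2$. -}

module Defs where

open import Data.Nat using (ℕ; zero; suc; _+_)
open import Data.Bool using (Bool; true; false; _∧_)
open import Data.Bool.Properties using () renaming (_≟_ to _≟ᵇ_)
open import Data.Product using (_×_; _,_)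
open import Data.List using (List; []; _∷_; map; concatMap; filterᵇ; _++_)
open import Data.Bool.ListAction using (any)
open import Data.Vec using (Vec; []; _∷_; take; drop) renaming (_++_ to _++ᵛ_)
open import Data.Vec.Properties using (≡-dec)
open import Data.Fin.Subset using (Subset; _⊆_; _∩_; _∪_; _─_; ⊥; ⊤)
open import Relation.Binary.PropositionalEquality using (_≡_)
open import Relation.Nullary.Decidable using (⌊_⌋)

-- The finite set X is modelled as Fin n; its subsets are Subset n.
-- A family of subsets of Fin n (an element of the powerset of the
-- powerset), in a canonical representation so that _≡_ is extensional
-- equality of families: a binary decision tree on membership.

Fam : ℕ → Set
Fam zero    = Bool
Fam (suc n) = Fam n × Fam n

mem : ∀ {n} → Fam n → Subset n → Bool
mem {zero}  b       []          = b
mem {suc n} (f , g) (false ∷ s) = mem f s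
mem {suc n} (f , g) (true  ∷ s) = mem g s

tab : ∀ {n} → (Subset n → Bool) → Fam n
tab {zero}  p = p []
tab {suc n} p = tab (λ s → p (false ∷ s)) , tab (λ s → p (true ∷ s))

allSubsets : ∀ n → List (Subset n)
allSubsets zero    = [] ∷ []
allSubsets (suc n) = map (false ∷_) (allSubsets n) ++ map (true ∷_) (allSubsets n)

_=ˢ_ : ∀ {n} → Subset n → Subset n → Bool
U =ˢ V = ⌊ ≡-dec _≟ᵇ_ U V ⌋

opens : ∀ {n} → Fam n → List (Subset n)
opens {n} T = filterᵇ (mem T) (allSubsets n)

record IsTopologyOn {n : ℕ} (S : Subset n) (T : Fam n) : Set where
  field
    opens⊆ : ∀ U → mem T U ≡ true → U ⊆ S
    ∅-open : mem T ⊥ ≡ true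
    S-open : mem T S ≡ true
    ∪-open : ∀ U V → mem T U ≡ true → mem T V ≡ true → mem T (U ∪ V) ≡ true
    ∩-open : ∀ U V → mem T U ≡ true → mem T V ≡ true → mem T (U ∩ V) ≡ true

IsTopology : ∀ n → Fam n → Set
IsTopology n T = IsTopologyOn ⊤ T

restrict : ∀ {n} → Fam n → Subset n → Fam n
restrict {n} T Y = tab (λ V → any (λ U → mem T U ∧ ((U ∩ Y) =ˢ V)) (allSubsets n))

-- Free (commutative-monoid / ℕ-linear) combinations of basis elements
-- are lists of basis elements; equality of such combinations is
-- equality up to permutation (_↭_).

-- Basis of ⊕_{Y ⊆ S} 𝕋_{S∖Y} ⊗ 𝕋_Y : triples (Y , A , B).
Basis₂ : ℕ → Set
Basis₂ n = Subset n × Fam n × Fam n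

-- Basis of ⊕_{Z ⊆ Y ⊆ X} 𝕋_{X∖Y} ⊗ 𝕋_{Y∖Z} ⊗ 𝕋_Z : (Y , Z , A , B , C).
Basis₃ : ℕ → Set
Basis₃ n = Subset n × Subset n × Fam n × Fam n × Fam n

Δ : ∀ {n} → Subset n → Fam n → List (Basis₂ n)
Δ S T = map (λ Y → (Y , restrict T (S ─ Y) , restrict T Y)) (opens T)

ΔI∘Δ : ∀ {n} → Fam n → List (Basis₃ n)
ΔI∘Δ T = concatMap
  (λ { (Z , A , C) → map (λ { (W , P , Q) → (W ∪ Z , Z , P , Q , C) }) (Δ (⊤ ─ Z) A) })
  (Δ ⊤ T)

IΔ∘Δ : ∀ {n} → Fam n → List (Basis₃ n)
IΔ∘Δ T = concatMap
  (λ { (Y , A , B) → map (λ { (Z , P , Q) → (Y , Z , A , P , Q) }) (Δ Y B) })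
  (Δ ⊤ T)

-- Disjoint union X₁ ⊔ X₂ = Fin (n₁ + n₂); a subset of it is s₁ ++ s₂.
-- Product of families:  Y ∈ T₁T₂  iff  Y ∩ X₁ ∈ T₁ and Y ∩ X₂ ∈ T₂.
mul : ∀ {n₁ n₂} → Fam n₁ → Fam n₂ → Fam (n₁ + n₂)
mul {n₁} T₁ T₂ = tab (λ Y → mem T₁ (take n₁ Y) ∧ mem T₂ (drop n₁ Y))

mm∘τ : ∀ {n₁ n₂} → List (Basis₂ n₁) → List (Basis₂ n₂) → List (Basis₂ (n₁ + n₂))
mm∘τ D₁ D₂ = concatMap
  (λ { (Y₁ , A₁ , B₁) → map (λ { (Y₂ , A₂ , B₂) → (Y₁ ++ᵛ Y₂ , mul A₁ A₂ , mul B₁ B₂) }) D₂ })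
  D₁

-- Both iterated coproducts are sums over the pairs Z ⊆ Y of open sets, with (Y, Z)-summand
-- T|X∖Y ⊗ (T|Y)|Y∖Z ⊗ (T|Y)|Z.  The side (I ⊗ Δ)Δ enumerates these pairs by the top Y and an
-- open set Z of T|Y; the side (Δ ⊗ I)Δ enumerates them by the bottom Z and an open set W of
-- T|X∖Z, with Y = W ∪ Z, and its summands become the ones above once (T|S)|R is rewritten as
-- T|S∩R.  Closure under ∩, respectively ∪, makes each enumeration reach exactly these pairs,
-- and neither repeats a pair, so the two sums agree up to the order of their terms.
-- Multiplicativity needs no topology axioms: the open sets of T₁T₂ are the Y₁ ⊔ Y₂ with Yᵢ
-- open in Tᵢ, and (T₁T₂)|S₁⊔S₂ = (T₁|S₁)(T₂|S₂).
module Submission where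

open import Defs
open import Data.Nat using (ℕ; zero; suc; _+_)
open import Data.Bool using (Bool; true; false; _∧_; T)
open import Data.Bool.Properties using (T-≡; T-∧; ⇔→≡; ∧-conicalˡ; ∧-conicalʳ)
open import Data.Product using (_×_; _,_; proj₁; proj₂; ∃; ∃₂)
open import Data.Vec using ([]; _∷_; take; drop; splitAt) renaming (_++_ to _++ᵛ_)
open import Data.Vec.Properties using (∷-injectiveʳ; take++drop≡id; zipWith-++; ++-injectiveʳ; ++-injective)
open import Data.Fin.Subset using (Subset; ⊤; _∩_; _∪_; _─_)
open import Data.Fin.Subset.Properties using (∩-assoc; ∩-comm; ∩-idem; ∪-comm; ∪-abs-∩; ∩-abs-∪)
open import Data.List using (List; []; _∷_; map; concatMap)
open import Data.List.Properties using (map-cong; map-∘; map-id-local; map-concatMap; concatMap-map; concatMap-cong)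
open import Data.List.Membership.Propositional using (_∈_; find; lose)
open import Data.List.Membership.Propositional.Properties
  using (∈-map⁺; ∈-map⁻; ∈-concatMap⁺; ∈-concatMap⁻; ∈-filter⁺; ∈-filter⁻; ∈-++⁺ˡ; ∈-++⁺ʳ)
open import Data.List.Membership.Propositional.Properties.WithK using (unique∧set⇒bag)
open import Data.List.Relation.Unary.All as All using (All; [])
open import Data.List.Relation.Unary.Any using (here)
open import Data.List.Relation.Unary.Any.Properties using (any⁺; any⁻)
open import Data.List.Relation.Unary.AllPairs using ([]; _∷_)
open import Data.List.Relation.Unary.Unique.Propositional using (Unique)
import Data.List.Relation.Unary.Unique.Propositional.Properties as Unique
open import Data.List.Relation.Binary.BagAndSetEquality using (∼bag⇒↭)
open import Data.List.Relation.Binary.Permutation.Propositional using (_↭_; module PermutationReasoning)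
import Data.List.Relation.Binary.Permutation.Propositional.Properties as ↭
open import Function using (_∘_; _⇔_; mk⇔; Equivalence)
import Function.Properties.Equivalence as ⇔
open import Relation.Binary.PropositionalEquality
open import Relation.Nullary using (¬_)
open import Relation.Nullary.Decidable using (T?; toWitness; fromWitness)

private
  variable
    A B C : Set

unique∧set⇒↭ : ∀ {xs ys : List A} → Unique xs → Unique ys → (∀ {x} → x ∈ xs ⇔ x ∈ ys) → xs ↭ ys
unique∧set⇒↭ xs! ys! xs≈ys = ∼bag⇒↭ (unique∧set⇒bag xs! ys! xs≈ys)

unique-map⁺ : ∀ {f : A → B} (g : B → A) {xs} → All (λ x → g (f x) ≡ x) xs → Unique xs → Unique (map f xs)
unique-map⁺ {f = f} g {xs} g∘f≗id xs! = Unique.map⁻ {f = g} (subst Unique (sym g∘f∘xs≡xs) xs!)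
  where
  g∘f∘xs≡xs : map g (map f xs) ≡ xs
  g∘f∘xs≡xs = trans (sym (map-∘ xs)) (map-id-local g∘f≗id)

dependentProductWith : (A → B → C) → List A → (A → List B) → List C
dependentProductWith g xs ys = concatMap (λ x → map (g x) (ys x)) xs

module _ {g : A → B → C} {ys : A → List B} where

  ∈-dependentProductWith⁺ : ∀ {xs x y} → x ∈ xs → y ∈ ys x → g x y ∈ dependentProductWith g xs ys
  ∈-dependentProductWith⁺ x∈xs y∈ys = ∈-concatMap⁺ (λ x → map (g x) (ys x)) (lose x∈xs (∈-map⁺ (g _) y∈ys))

  ∈-dependentProductWith⁻ : ∀ xs {v} → v ∈ dependentProductWith g xs ys →
                            ∃₂ λ x y → x ∈ xs × y ∈ ys x × v ≡ g x y
  ∈-dependentProductWith⁻ xs v∈ with find (∈-concatMap⁻ (λ x → map (g x) (ys x)) {xs = xs} v∈)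
  ... | x , x∈xs , v∈map with ∈-map⁻ (g x) v∈map
  ... | y , y∈ys , v≡gxy = x , y , x∈xs , y∈ys , v≡gxy

  unique-dependentProductWith⁺ : (key : C → A) → (∀ x y → key (g x y) ≡ x) → ∀ {xs} → Unique xs →
                                 (∀ x → Unique (map (g x) (ys x))) → Unique (dependentProductWith g xs ys)
  unique-dependentProductWith⁺ key key∘g {[]}     []          blocks! = []
  unique-dependentProductWith⁺ key key∘g {x ∷ xs} (x∉xs ∷ xs!) blocks! =
    Unique.++⁺ (blocks! x) (unique-dependentProductWith⁺ key key∘g xs! blocks!) disjoint
    where
    disjoint : ∀ {v} → ¬ (v ∈ map (g x) (ys x) × v ∈ dependentProductWith g xs ys)
    disjoint (v∈block , v∈rest) with ∈-map⁻ (g x) v∈block | ∈-dependentProductWith⁻ xs v∈rest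
    ... | y , _ , refl | x′ , y′ , x′∈xs , _ , gxy≡gx′y′ =
      All.lookup x∉xs x′∈xs (trans (sym (key∘g x y)) (trans (cong key gxy≡gx′y′) (key∘g x′ y′)))

  concatMap-map-dependentProductWith : ∀ {D : Set} {F : D → List C} (f : A → D) xs →
                                       (∀ x → F (f x) ≡ map (g x) (ys x)) →
                                       concatMap F (map f xs) ≡ dependentProductWith g xs ys
  concatMap-map-dependentProductWith {F = F} f xs F∘f≡ =
    trans (concatMap-map F f xs) (concatMap-cong F∘f≡ xs)

map-dependentProductWith : ∀ {D : Set} (h : C → D) (g : A → B → C) xs ys →
                           map h (dependentProductWith g xs ys) ≡ dependentProductWith (λ x y → h (g x y)) xs ys
map-dependentProductWith h g xs ys =
  trans (map-concatMap h _ xs) (concatMap-cong (λ x → sym (map-∘ (ys x))) xs)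

dependentProductWith-cong : ∀ {g g′ : A → B → C} → (∀ x y → g x y ≡ g′ x y) → ∀ xs ys →
                            dependentProductWith g xs ys ≡ dependentProductWith g′ xs ys
dependentProductWith-cong g≗g′ xs ys =
  concatMap-cong (λ x → map-cong (g≗g′ x) (ys x)) xs

p∩[⊤─q]∪q≡p∪q : ∀ {n} (p q : Subset n) → p ∩ (⊤ ─ q) ∪ q ≡ p ∪ q
p∩[⊤─q]∪q≡p∪q []          []          = refl
p∩[⊤─q]∪q≡p∪q (false ∷ p) (false ∷ q) = cong (_ ∷_) (p∩[⊤─q]∪q≡p∪q p q)
p∩[⊤─q]∪q≡p∪q (false ∷ p) (true  ∷ q) = cong (_ ∷_) (p∩[⊤─q]∪q≡p∪q p q)
p∩[⊤─q]∪q≡p∪q (true  ∷ p) (false ∷ q) = cong (_ ∷_) (p∩[⊤─q]∪q≡p∪q p q)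
p∩[⊤─q]∪q≡p∪q (true  ∷ p) (true  ∷ q) = cong (_ ∷_) (p∩[⊤─q]∪q≡p∪q p q)

[p∩[⊤─q]∪q]∩[⊤─q]≡p∩[⊤─q] : ∀ {n} (p q : Subset n) → (p ∩ (⊤ ─ q) ∪ q) ∩ (⊤ ─ q) ≡ p ∩ (⊤ ─ q)
[p∩[⊤─q]∪q]∩[⊤─q]≡p∩[⊤─q] []          []          = refl
[p∩[⊤─q]∪q]∩[⊤─q]≡p∩[⊤─q] (false ∷ p) (false ∷ q) = cong (_ ∷_) ([p∩[⊤─q]∪q]∩[⊤─q]≡p∩[⊤─q] p q)
[p∩[⊤─q]∪q]∩[⊤─q]≡p∩[⊤─q] (false ∷ p) (true  ∷ q) = cong (_ ∷_) ([p∩[⊤─q]∪q]∩[⊤─q]≡p∩[⊤─q] p q)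
[p∩[⊤─q]∪q]∩[⊤─q]≡p∩[⊤─q] (true  ∷ p) (false ∷ q) = cong (_ ∷_) ([p∩[⊤─q]∪q]∩[⊤─q]≡p∩[⊤─q] p q)
[p∩[⊤─q]∪q]∩[⊤─q]≡p∩[⊤─q] (true  ∷ p) (true  ∷ q) = cong (_ ∷_) ([p∩[⊤─q]∪q]∩[⊤─q]≡p∩[⊤─q] p q)

[⊤─q]∩[⊤─q─p]≡⊤─[p∪q] : ∀ {n} (p q : Subset n) → (⊤ ─ q) ∩ ((⊤ ─ q) ─ p) ≡ ⊤ ─ (p ∪ q)
[⊤─q]∩[⊤─q─p]≡⊤─[p∪q] []          []          = refl
[⊤─q]∩[⊤─q─p]≡⊤─[p∪q] (false ∷ p) (false ∷ q) = cong (_ ∷_) ([⊤─q]∩[⊤─q─p]≡⊤─[p∪q] p q)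
[⊤─q]∩[⊤─q─p]≡⊤─[p∪q] (false ∷ p) (true  ∷ q) = cong (_ ∷_) ([⊤─q]∩[⊤─q─p]≡⊤─[p∪q] p q)
[⊤─q]∩[⊤─q─p]≡⊤─[p∪q] (true  ∷ p) (false ∷ q) = cong (_ ∷_) ([⊤─q]∩[⊤─q─p]≡⊤─[p∪q] p q)
[⊤─q]∩[⊤─q─p]≡⊤─[p∪q] (true  ∷ p) (true  ∷ q) = cong (_ ∷_) ([⊤─q]∩[⊤─q─p]≡⊤─[p∪q] p q)

[⊤─q]∩p≡[p∪q]∩[p∪q─q] : ∀ {n} (p q : Subset n) → (⊤ ─ q) ∩ p ≡ (p ∪ q) ∩ ((p ∪ q) ─ q)
[⊤─q]∩p≡[p∪q]∩[p∪q─q] []          []          = refl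
[⊤─q]∩p≡[p∪q]∩[p∪q─q] (false ∷ p) (false ∷ q) = cong (_ ∷_) ([⊤─q]∩p≡[p∪q]∩[p∪q─q] p q)
[⊤─q]∩p≡[p∪q]∩[p∪q─q] (false ∷ p) (true  ∷ q) = cong (_ ∷_) ([⊤─q]∩p≡[p∪q]∩[p∪q─q] p q)
[⊤─q]∩p≡[p∪q]∩[p∪q─q] (true  ∷ p) (false ∷ q) = cong (_ ∷_) ([⊤─q]∩p≡[p∪q]∩[p∪q─q] p q)
[⊤─q]∩p≡[p∪q]∩[p∪q─q] (true  ∷ p) (true  ∷ q) = cong (_ ∷_) ([⊤─q]∩p≡[p∪q]∩[p∪q─q] p q)

[p∪q]∩q≡q : ∀ {n} (p q : Subset n) → (p ∪ q) ∩ q ≡ q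
[p∪q]∩q≡q p q = trans (∩-comm (p ∪ q) q) (trans (cong (q ∩_) (∪-comm p q)) (∩-abs-∪ q p))

⊤─[p++q]≡[⊤─p]++[⊤─q] : ∀ {n₁ n₂} (p : Subset n₁) (q : Subset n₂) → ⊤ ─ (p ++ᵛ q) ≡ (⊤ ─ p) ++ᵛ (⊤ ─ q)
⊤─[p++q]≡[⊤─p]++[⊤─q] []      q = refl
⊤─[p++q]≡[⊤─p]++[⊤─q] (_ ∷ p) q = cong (_ ∷_) (⊤─[p++q]≡[⊤─p]++[⊤─q] p q)

mem-tab : ∀ {n} (p : Subset n → Bool) U → mem (tab p) U ≡ p U
mem-tab p []          = refl
mem-tab p (false ∷ U) = mem-tab (λ V → p (false ∷ V)) U
mem-tab p (true  ∷ U) = mem-tab (λ V → p (true ∷ V)) U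

mem-ext : ∀ {n} {F G : Fam n} → (∀ U → mem F U ≡ mem G U) → F ≡ G
mem-ext {zero} F≗G = F≗G []
mem-ext {suc n} F≗G =
  cong₂ _,_ (mem-ext (λ U → F≗G (false ∷ U))) (mem-ext (λ U → F≗G (true ∷ U)))

∈-allSubsets : ∀ {n} (U : Subset n) → U ∈ allSubsets n
∈-allSubsets []          = here refl
∈-allSubsets (false ∷ U) = ∈-++⁺ˡ (∈-map⁺ (false ∷_) (∈-allSubsets U))
∈-allSubsets {n = suc n} (true ∷ U) =
  ∈-++⁺ʳ (map (false ∷_) (allSubsets n)) (∈-map⁺ (true ∷_) (∈-allSubsets U))

allSubsets-unique : ∀ n → Unique (allSubsets n)
allSubsets-unique zero    = [] ∷ []
allSubsets-unique (suc n) =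
  Unique.++⁺ (Unique.map⁺ ∷-injectiveʳ (allSubsets-unique n)) (Unique.map⁺ ∷-injectiveʳ (allSubsets-unique n))
             disjoint
  where
  disjoint : ∀ {U} → ¬ (U ∈ map (false ∷_) (allSubsets n) × U ∈ map (true ∷_) (allSubsets n))
  disjoint (U∈₀ , U∈₁) with ∈-map⁻ (false ∷_) U∈₀ | ∈-map⁻ (true ∷_) U∈₁
  ... | _ , _ , refl | _ , _ , ()

module _ {n} {F : Fam n} where

  ∈-opens⁺ : ∀ {U} → mem F U ≡ true → U ∈ opens F
  ∈-opens⁺ {U} U∈F = ∈-filter⁺ (T? ∘ mem F) (∈-allSubsets U) (Equivalence.from T-≡ U∈F)

  ∈-opens⁻ : ∀ {U} → U ∈ opens F → mem F U ≡ true
  ∈-opens⁻ U∈ = Equivalence.to T-≡ (proj₂ (∈-filter⁻ (T? ∘ mem F) {xs = allSubsets n} U∈))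

  opens-unique : Unique (opens F)
  opens-unique = Unique.filter⁺ (T? ∘ mem F) (allSubsets-unique n)

  mem-restrict⁺ : ∀ {S U V} → mem F U ≡ true → U ∩ S ≡ V → mem (restrict F S) V ≡ true
  mem-restrict⁺ {S} {U} U∈F refl =
    trans (mem-tab _ (U ∩ S)) (Equivalence.to T-≡ (any⁺ _ (lose (∈-allSubsets U) U-witness)))
    where
    U-witness : T (mem F U ∧ ((U ∩ S) =ˢ (U ∩ S)))
    U-witness = Equivalence.from T-∧ (Equivalence.from T-≡ U∈F , fromWitness refl)

  mem-restrict⁻ : ∀ {S V} → mem (restrict F S) V ≡ true → ∃ λ U → mem F U ≡ true × U ∩ S ≡ V
  mem-restrict⁻ {S} {V} V∈F|S
    with find (any⁻ _ (allSubsets n) (Equivalence.from T-≡ (trans (sym (mem-tab _ V)) V∈F|S)))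
  ... | U , _ , witness with Equivalence.to T-∧ witness
  ... | U∈F , U∩S≡V = U , Equivalence.to T-≡ U∈F , toWitness U∩S≡V

restrict-restrict : ∀ {n} (F : Fam n) S R → restrict (restrict F S) R ≡ restrict F (S ∩ R)
restrict-restrict F S R = mem-ext λ V → ⇔→≡ (mk⇔ to from)
  where
  to : ∀ {V} → mem (restrict (restrict F S) R) V ≡ true → mem (restrict F (S ∩ R)) V ≡ true
  to V∈ with mem-restrict⁻ {S = R} V∈
  ... | _ , U′∈ , refl with mem-restrict⁻ {S = S} U′∈
  ... | U , U∈F , refl = mem-restrict⁺ U∈F (sym (∩-assoc U S R))

  from : ∀ {V} → mem (restrict F (S ∩ R)) V ≡ true → mem (restrict (restrict F S) R) V ≡ true
  from V∈ with mem-restrict⁻ {S = S ∩ R} V∈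
  ... | U , U∈F , refl = mem-restrict⁺ (mem-restrict⁺ {F = F} U∈F refl) (∩-assoc U S R)

ClosedUnder : ∀ {n} → (Subset n → Subset n → Subset n) → Fam n → Set
ClosedUnder _∙_ F = ∀ U V → mem F U ≡ true → mem F V ≡ true → mem F (U ∙ V) ≡ true

IsOpenFlag : ∀ {n} → Fam n → Subset n × Subset n → Set
IsOpenFlag F (Y , Z) = mem F Y ≡ true × mem F Z ≡ true × Y ∩ Z ≡ Z

flagsByTop : ∀ {n} → Fam n → List (Subset n × Subset n)
flagsByTop F = dependentProductWith _,_ (opens F) (λ Y → opens (restrict F Y))

flagsByBottom : ∀ {n} → Fam n → List (Subset n × Subset n)
flagsByBottom F = dependentProductWith (λ Z W → W ∪ Z , Z) (opens F) (λ Z → opens (restrict F (⊤ ─ Z)))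

Δ²-summand : ∀ {n} → Fam n → Subset n × Subset n → Basis₃ n
Δ²-summand F (Y , Z) = Y , Z , restrict F (⊤ ─ Y) , restrict (restrict F Y) (Y ─ Z) , restrict (restrict F Y) Z

module _ {n} (F : Fam n) where

  IΔ∘Δ≡map-flagsByTop : IΔ∘Δ F ≡ map (Δ²-summand F) (flagsByTop F)
  IΔ∘Δ≡map-flagsByTop =
    trans (concatMap-map-dependentProductWith _ (opens F) (λ Y → sym (map-∘ (opens (restrict F Y)))))
          (sym (map-dependentProductWith (Δ²-summand F) _,_ (opens F) _))

  ΔI∘Δ≡map-flagsByBottom : ΔI∘Δ F ≡ map (Δ²-summand F) (flagsByBottom F)
  ΔI∘Δ≡map-flagsByBottom =
    trans (concatMap-map-dependentProductWith _ (opens F)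
            (λ Z → trans (sym (map-∘ _)) (map-cong (summand≡ Z) (opens (restrict F (⊤ ─ Z))))))
          (sym (map-dependentProductWith (Δ²-summand F) _ (opens F) _))
    where
    summand≡ : ∀ Z W → (W ∪ Z , Z , restrict (restrict F (⊤ ─ Z)) ((⊤ ─ Z) ─ W) ,
                        restrict (restrict F (⊤ ─ Z)) W , restrict F Z)
                       ≡ Δ²-summand F (W ∪ Z , Z)
    summand≡ Z W = cong₂ (λ A PQ → W ∪ Z , Z , A , PQ) A≡ (cong₂ _,_ P≡ Q≡)
      where
      A≡ : restrict (restrict F (⊤ ─ Z)) ((⊤ ─ Z) ─ W) ≡ restrict F (⊤ ─ (W ∪ Z))
      A≡ = trans (restrict-restrict F _ _) (cong (restrict F) ([⊤─q]∩[⊤─q─p]≡⊤─[p∪q] W Z))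
      P≡ : restrict (restrict F (⊤ ─ Z)) W ≡ restrict (restrict F (W ∪ Z)) ((W ∪ Z) ─ Z)
      P≡ = trans (restrict-restrict F _ _)
                 (trans (cong (restrict F) ([⊤─q]∩p≡[p∪q]∩[p∪q─q] W Z)) (sym (restrict-restrict F _ _)))
      Q≡ : restrict F Z ≡ restrict (restrict F (W ∪ Z)) Z
      Q≡ = trans (cong (restrict F) (sym ([p∪q]∩q≡q W Z))) (sym (restrict-restrict F _ _))

module _ {n} {F : Fam n} where

  ∈-flagsByTop : ClosedUnder _∩_ F → ∀ {p} → p ∈ flagsByTop F ⇔ IsOpenFlag F p
  ∈-flagsByTop ∩-open = mk⇔ to from
    where
    to : ∀ {p} → p ∈ flagsByTop F → IsOpenFlag F p
    to p∈ with ∈-dependentProductWith⁻ (opens F) p∈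
    ... | Y , Z , Y∈ , Z∈ , refl with mem-restrict⁻ {S = Y} (∈-opens⁻ Z∈)
    ... | V , V∈F , refl = ∈-opens⁻ Y∈ , ∩-open V Y V∈F (∈-opens⁻ Y∈) , Y∩[V∩Y]≡V∩Y
      where
      Y∩[V∩Y]≡V∩Y : Y ∩ (V ∩ Y) ≡ V ∩ Y
      Y∩[V∩Y]≡V∩Y = trans (∩-comm Y (V ∩ Y)) (trans (∩-assoc V Y Y) (cong (V ∩_) (∩-idem Y)))

    from : ∀ {p} → IsOpenFlag F p → p ∈ flagsByTop F
    from {Y , Z} (Y∈F , Z∈F , Y∩Z≡Z) =
      ∈-dependentProductWith⁺ (∈-opens⁺ {F = F} Y∈F)
        (∈-opens⁺ {F = restrict F Y} (mem-restrict⁺ Z∈F (trans (∩-comm Z Y) Y∩Z≡Z)))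

  ∈-flagsByBottom : ClosedUnder _∪_ F → ∀ {p} → p ∈ flagsByBottom F ⇔ IsOpenFlag F p
  ∈-flagsByBottom ∪-open = mk⇔ to from
    where
    to : ∀ {p} → p ∈ flagsByBottom F → IsOpenFlag F p
    to p∈ with ∈-dependentProductWith⁻ (opens F) p∈
    ... | Z , W , Z∈ , W∈ , refl with mem-restrict⁻ {S = ⊤ ─ Z} (∈-opens⁻ W∈)
    ... | U , U∈F , refl = Y∈F , ∈-opens⁻ Z∈ , [p∪q]∩q≡q (U ∩ (⊤ ─ Z)) Z
      where
      Y∈F : mem F (U ∩ (⊤ ─ Z) ∪ Z) ≡ true
      Y∈F = subst (λ Y → mem F Y ≡ true) (sym (p∩[⊤─q]∪q≡p∪q U Z)) (∪-open U Z U∈F (∈-opens⁻ Z∈))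

    from : ∀ {p} → IsOpenFlag F p → p ∈ flagsByBottom F
    from {Y , Z} (Y∈F , Z∈F , Y∩Z≡Z) =
      subst (λ W∪Z → (W∪Z , Z) ∈ flagsByBottom F) W∪Z≡Y
            (∈-dependentProductWith⁺ (∈-opens⁺ {F = F} Z∈F)
              (∈-opens⁺ {F = restrict F (⊤ ─ Z)} (mem-restrict⁺ {F = F} Y∈F refl)))
      where
      W∪Z≡Y : Y ∩ (⊤ ─ Z) ∪ Z ≡ Y
      W∪Z≡Y = begin
        Y ∩ (⊤ ─ Z) ∪ Z  ≡⟨ p∩[⊤─q]∪q≡p∪q Y Z ⟩
        Y ∪ Z            ≡⟨ cong (Y ∪_) Y∩Z≡Z ⟨
        Y ∪ (Y ∩ Z)      ≡⟨ ∪-abs-∩ Y Z ⟩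
        Y                ∎
        where open ≡-Reasoning

  flagsByTop-unique : Unique (flagsByTop F)
  flagsByTop-unique =
    unique-dependentProductWith⁺ proj₁ (λ _ _ → refl) opens-unique (λ _ → Unique.map⁺ (cong proj₂) opens-unique)

  flagsByBottom-unique : Unique (flagsByBottom F)
  flagsByBottom-unique =
    unique-dependentProductWith⁺ proj₂ (λ _ _ → refl) opens-unique
      (λ Z → unique-map⁺ (λ (Y , Z) → Y ∩ (⊤ ─ Z)) (All.tabulate (W∪Z∩[⊤─Z]≡W Z)) opens-unique)
    where
    W∪Z∩[⊤─Z]≡W : ∀ Z {W} → W ∈ opens (restrict F (⊤ ─ Z)) → (W ∪ Z) ∩ (⊤ ─ Z) ≡ W
    W∪Z∩[⊤─Z]≡W Z W∈ with mem-restrict⁻ {S = ⊤ ─ Z} (∈-opens⁻ W∈)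
    ... | U , _ , refl = [p∩[⊤─q]∪q]∩[⊤─q]≡p∩[⊤─q] U Z

  flagsByBottom↭flagsByTop : ClosedUnder _∪_ F → ClosedUnder _∩_ F → flagsByBottom F ↭ flagsByTop F
  flagsByBottom↭flagsByTop ∪-open ∩-open =
    unique∧set⇒↭ flagsByBottom-unique flagsByTop-unique
      (⇔.trans (∈-flagsByBottom ∪-open) (⇔.sym (∈-flagsByTop ∩-open)))

coassociative : ∀ {n} (F : Fam n) → ClosedUnder _∪_ F → ClosedUnder _∩_ F → ΔI∘Δ F ↭ IΔ∘Δ F
coassociative F ∪-open ∩-open = begin
  ΔI∘Δ F                               ≡⟨ ΔI∘Δ≡map-flagsByBottom F ⟩
  map (Δ²-summand F) (flagsByBottom F)  ↭⟨ ↭.map⁺ (Δ²-summand F) (flagsByBottom↭flagsByTop ∪-open ∩-open) ⟩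
  map (Δ²-summand F) (flagsByTop F)     ≡⟨ IΔ∘Δ≡map-flagsByTop F ⟨
  IΔ∘Δ F                               ∎
  where open PermutationReasoning

module _ {n₁ n₂ : ℕ} where

  take-++ : ∀ (U₁ : Subset n₁) (U₂ : Subset n₂) → take n₁ (U₁ ++ᵛ U₂) ≡ U₁
  take-++ U₁ U₂ = proj₁ (++-injective _ U₁ (take++drop≡id n₁ (U₁ ++ᵛ U₂)))

  drop-++ : ∀ (U₁ : Subset n₁) (U₂ : Subset n₂) → drop n₁ (U₁ ++ᵛ U₂) ≡ U₂
  drop-++ U₁ U₂ = proj₂ (++-injective _ U₁ (take++drop≡id n₁ (U₁ ++ᵛ U₂)))

  mem-mul : ∀ (F₁ : Fam n₁) (F₂ : Fam n₂) U₁ U₂ → mem (mul F₁ F₂) (U₁ ++ᵛ U₂) ≡ mem F₁ U₁ ∧ mem F₂ U₂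
  mem-mul F₁ F₂ U₁ U₂ =
    trans (mem-tab _ (U₁ ++ᵛ U₂)) (cong₂ (λ V₁ V₂ → mem F₁ V₁ ∧ mem F₂ V₂) (take-++ U₁ U₂) (drop-++ U₁ U₂))

  mem-mul⁺ : ∀ (F₁ : Fam n₁) (F₂ : Fam n₂) {U₁ U₂} → mem F₁ U₁ ≡ true → mem F₂ U₂ ≡ true →
             mem (mul F₁ F₂) (U₁ ++ᵛ U₂) ≡ true
  mem-mul⁺ F₁ F₂ {U₁} {U₂} U₁∈ U₂∈ = trans (mem-mul F₁ F₂ U₁ U₂) (cong₂ _∧_ U₁∈ U₂∈)

  mem-mul⁻ : ∀ {F₁ : Fam n₁} {F₂ : Fam n₂} U₁ U₂ → mem (mul F₁ F₂) (U₁ ++ᵛ U₂) ≡ true →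
             mem F₁ U₁ ≡ true × mem F₂ U₂ ≡ true
  mem-mul⁻ {F₁} {F₂} U₁ U₂ U∈ = ∧-conicalˡ _ _ U∈′ , ∧-conicalʳ _ _ U∈′
    where
    U∈′ : mem F₁ U₁ ∧ mem F₂ U₂ ≡ true
    U∈′ = trans (sym (mem-mul F₁ F₂ U₁ U₂)) U∈

  opens-mul : ∀ (F₁ : Fam n₁) (F₂ : Fam n₂) →
              opens (mul F₁ F₂) ↭ dependentProductWith _++ᵛ_ (opens F₁) (λ _ → opens F₂)
  opens-mul F₁ F₂ = unique∧set⇒↭ opens-unique product-unique (mk⇔ to from)
    where
    product-unique : Unique (dependentProductWith _++ᵛ_ (opens F₁) (λ _ → opens F₂))
    product-unique = unique-dependentProductWith⁺ (take n₁) take-++ opens-unique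
                       (λ U₁ → Unique.map⁺ (++-injectiveʳ U₁ U₁) opens-unique)

    to : ∀ {U} → U ∈ opens (mul F₁ F₂) → U ∈ dependentProductWith _++ᵛ_ (opens F₁) (λ _ → opens F₂)
    to {U} U∈ with splitAt n₁ U
    ... | U₁ , U₂ , refl with mem-mul⁻ U₁ U₂ (∈-opens⁻ U∈)
    ... | U₁∈ , U₂∈ = ∈-dependentProductWith⁺ (∈-opens⁺ {F = F₁} U₁∈) (∈-opens⁺ {F = F₂} U₂∈)

    from : ∀ {U} → U ∈ dependentProductWith _++ᵛ_ (opens F₁) (λ _ → opens F₂) → U ∈ opens (mul F₁ F₂)
    from U∈ with ∈-dependentProductWith⁻ (opens F₁) U∈
    ... | U₁ , U₂ , U₁∈ , U₂∈ , refl = ∈-opens⁺ (mem-mul⁺ F₁ F₂ (∈-opens⁻ U₁∈) (∈-opens⁻ U₂∈))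

  restrict-mul : ∀ (F₁ : Fam n₁) (F₂ : Fam n₂) S₁ S₂ →
                 restrict (mul F₁ F₂) (S₁ ++ᵛ S₂) ≡ mul (restrict F₁ S₁) (restrict F₂ S₂)
  restrict-mul F₁ F₂ S₁ S₂ = mem-ext λ V → ⇔→≡ (mk⇔ to from)
    where
    to : ∀ {V} → mem (restrict (mul F₁ F₂) (S₁ ++ᵛ S₂)) V ≡ true →
         mem (mul (restrict F₁ S₁) (restrict F₂ S₂)) V ≡ true
    to {V} V∈ with splitAt n₁ V | mem-restrict⁻ {S = S₁ ++ᵛ S₂} V∈
    ... | V₁ , V₂ , refl | U , U∈ , U∩S≡V with splitAt n₁ U
    ... | U₁ , U₂ , refl
        with mem-mul⁻ U₁ U₂ U∈ | ++-injective (U₁ ∩ S₁) V₁ (trans (sym (zipWith-++ _∧_ U₁ U₂ S₁ S₂)) U∩S≡V)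
    ... | U₁∈ , U₂∈ | U₁∩S₁≡V₁ , U₂∩S₂≡V₂ =
      mem-mul⁺ (restrict F₁ S₁) (restrict F₂ S₂) (mem-restrict⁺ U₁∈ U₁∩S₁≡V₁) (mem-restrict⁺ U₂∈ U₂∩S₂≡V₂)

    from : ∀ {V} → mem (mul (restrict F₁ S₁) (restrict F₂ S₂)) V ≡ true →
           mem (restrict (mul F₁ F₂) (S₁ ++ᵛ S₂)) V ≡ true
    from {V} V∈ with splitAt n₁ V
    ... | V₁ , V₂ , refl with mem-mul⁻ V₁ V₂ V∈
    ... | V₁∈ , V₂∈ with mem-restrict⁻ {S = S₁} V₁∈ | mem-restrict⁻ {S = S₂} V₂∈
    ... | U₁ , U₁∈ , refl | U₂ , U₂∈ , refl = mem-restrict⁺ (mem-mul⁺ F₁ F₂ U₁∈ U₂∈) (zipWith-++ _∧_ U₁ U₂ S₁ S₂)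

Δ-summand : ∀ {n} → Fam n → Subset n → Basis₂ n
Δ-summand F Y = Y , restrict F (⊤ ─ Y) , restrict F Y

mul-summand : ∀ {n₁ n₂} → Fam n₁ → Fam n₂ → Subset n₁ → Subset n₂ → Basis₂ (n₁ + n₂)
mul-summand F₁ F₂ Y₁ Y₂ =
  Y₁ ++ᵛ Y₂ , mul (restrict F₁ (⊤ ─ Y₁)) (restrict F₂ (⊤ ─ Y₂)) , mul (restrict F₁ Y₁) (restrict F₂ Y₂)

Δ-summand-mul : ∀ {n₁ n₂} (F₁ : Fam n₁) (F₂ : Fam n₂) Y₁ Y₂ →
                Δ-summand (mul F₁ F₂) (Y₁ ++ᵛ Y₂) ≡ mul-summand F₁ F₂ Y₁ Y₂
Δ-summand-mul F₁ F₂ Y₁ Y₂ = cong₂ (λ A B → Y₁ ++ᵛ Y₂ , A , B)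
  (trans (cong (restrict (mul F₁ F₂)) (⊤─[p++q]≡[⊤─p]++[⊤─q] Y₁ Y₂)) (restrict-mul F₁ F₂ _ _))
  (restrict-mul F₁ F₂ Y₁ Y₂)

multiplicative : ∀ {n₁ n₂} (F₁ : Fam n₁) (F₂ : Fam n₂) → Δ ⊤ (mul F₁ F₂) ↭ mm∘τ (Δ ⊤ F₁) (Δ ⊤ F₂)
multiplicative F₁ F₂ = begin
  Δ ⊤ (mul F₁ F₂)
    ≡⟨⟩
  map (Δ-summand (mul F₁ F₂)) (opens (mul F₁ F₂))
    ↭⟨ ↭.map⁺ _ (opens-mul F₁ F₂) ⟩
  map (Δ-summand (mul F₁ F₂)) (dependentProductWith _++ᵛ_ (opens F₁) (λ _ → opens F₂))
    ≡⟨ map-dependentProductWith _ _ (opens F₁) _ ⟩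
  dependentProductWith (λ Y₁ Y₂ → Δ-summand (mul F₁ F₂) (Y₁ ++ᵛ Y₂)) (opens F₁) (λ _ → opens F₂)
    ≡⟨ dependentProductWith-cong (Δ-summand-mul F₁ F₂) (opens F₁) _ ⟩
  dependentProductWith (mul-summand F₁ F₂) (opens F₁) (λ _ → opens F₂)
    ≡⟨ concatMap-map-dependentProductWith _ (opens F₁) (λ _ → sym (map-∘ (opens F₂))) ⟨
  mm∘τ (Δ ⊤ F₁) (Δ ⊤ F₂)
    ∎
  where open PermutationReasoning

proposition3p4 : (∀ (n : ℕ) (T : Fam n) → IsTopology n T → ΔI∘Δ T ↭ IΔ∘Δ T)
    × (∀ (n₁ n₂ : ℕ) (T₁ : Fam n₁) (T₂ : Fam n₂) → IsTopology n₁ T₁ → IsTopology n₂ T₂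
    → Δ ⊤ (mul T₁ T₂) ↭ mm∘τ (Δ ⊤ T₁) (Δ ⊤ T₂))
proposition3p4 =
  (λ n T T-topology → coassociative T (IsTopologyOn.∪-open T-topology) (IsTopologyOn.∩-open T-topology)) ,
  (λ n₁ n₂ T₁ T₂ _ _ → multiplicative T₁ T₂)
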